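{- The satisfiability problem for $\mathrm{MLuC}^{\subseteq}$ is decidable: there is an algorithm which, given any finite conjunction of literals, each being an atom of one of the forms $x=y\cup z$, $x=y\setminus z$, $x\subseteq y\otimes z$ (with $x,y,z$ set variables) or the negation of such an atom, decides whether there is a set assignment satisfying it.
   Context: A set assignment maps set variables to well-founded sets (sets in the von Neumann cumulative hierarchy), and the symbols are interpreted as usual: $\cup$ union, $\setminus$ set difference, $\subseteq$ inclusion, and $s\otimes t=\{\{u,u'\}: u\in s,\ u'\in t\}$ (unordered Cartesian product). A conjunction is satisfiable if some set assignment makes all its literals true. -}

module Defs where

open import Level using (Level; _⊔_; Lift; lift; Setω) renaming (suc to lsuc; zero to lzero)
open import Data.Nat using (ℕ)
open import Data.Bool using (Bool; true; false)
open import Data.Product using (Σ; _×_; _,_; proj₁; proj₂)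
open import Data.Sum using (_⊎_; inj₁; inj₂)
open import Data.List using (List)
open import Data.List.Relation.Unary.All using (All)
open import Relation.Nullary using (¬_)
open import Relation.Binary.PropositionalEquality using (_≡_)
open import Function.Bundles using (_⇔_)
open import Axiom.ExcludedMiddle using (ExcludedMiddle)

-- Well-founded sets: Aczel's iterative sets (W-type of sets indexed by
-- types in Set ℓ), with extensional equality and membership.

data V (ℓ : Level) : Set (lsuc ℓ) where
  sup : (I : Set ℓ) → (I → V ℓ) → V ℓ

module _ {ℓ : Level} where

  _≐_ : V ℓ → V ℓ → Set ℓ
  sup A f ≐ sup B g =
    ((a : A) → Σ B (λ b → f a ≐ g b)) × ((b : B) → Σ A (λ a → f a ≐ g b))

  _∈V_ : V ℓ → V ℓ → Set ℓ
  x ∈V sup A f = Σ A (λ a → x ≐ f a)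

  _⊆V_ : V ℓ → V ℓ → Set ℓ
  sup A f ⊆V y = (a : A) → f a ∈V y

  _∪V_ : V ℓ → V ℓ → V ℓ
  sup A f ∪V sup B g = sup (A ⊎ B) h
    where
      h : A ⊎ B → V ℓ
      h (inj₁ a) = f a
      h (inj₂ b) = g b

  _∖V_ : V ℓ → V ℓ → V ℓ
  sup A f ∖V y = sup (Σ A (λ a → ¬ (f a ∈V y))) (λ p → f (proj₁ p))

  pairV : V ℓ → V ℓ → V ℓ
  pairV u v = sup (Lift ℓ Bool) h
    where
      h : Lift ℓ Bool → V ℓ
      h (lift true)  = u
      h (lift false) = v

  _⊗V_ : V ℓ → V ℓ → V ℓ
  sup A f ⊗V sup B g = sup (A × B) (λ p → pairV (f (proj₁ p)) (g (proj₂ p)))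

Var : Set
Var = ℕ

data Atom : Set where
  union   : Var → Var → Var → Atom
  diff    : Var → Var → Var → Atom
  subProd : Var → Var → Var → Atom

data Literal : Set where
  pos : Atom → Literal
  neg : Atom → Literal

Formula : Set
Formula = List Literal

Assignment : (ℓ : Level) → Set (lsuc ℓ)
Assignment ℓ = Var → V ℓ

module _ {ℓ : Level} (M : Assignment ℓ) where

  ⟦_⟧ᵃ : Atom → Set ℓ
  ⟦ union x y z ⟧ᵃ   = M x ≐ (M y ∪V M z)
  ⟦ diff x y z ⟧ᵃ    = M x ≐ (M y ∖V M z)
  ⟦ subProd x y z ⟧ᵃ = M x ⊆V (M y ⊗V M z)

  ⟦_⟧ˡ : Literal → Set ℓ
  ⟦ pos a ⟧ˡ = ⟦ a ⟧ᵃ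
  ⟦ neg a ⟧ˡ = ¬ ⟦ a ⟧ᵃ

Satisfiable : (ℓ : Level) → Formula → Set (lsuc ℓ)
Satisfiable ℓ φ = Σ (Assignment ℓ) (λ M → All ⟦ M ⟧ˡ φ)

-- Decidability: an algorithm (a closed Agda function, hence computable,
-- not depending on any classical axiom) returning true exactly on the
-- satisfiable conjunctions. Correctness is proved relative to classical
-- logic (the paper's metatheory), at every universe level.

record SatDecider : Setω where
  field
    decide  : Formula → Bool
    correct : (ℓ : Level) → ExcludedMiddle (lsuc ℓ) →
              (φ : Formula) → (decide φ ≡ true) ⇔ Satisfiable ℓ φ

-- Call the Venn region of a set e in an assignment M the set of variables v
-- with e ∈ M v. Union and difference literals hold iff they hold region by
-- region, while x ⊆ y ⊗ z forces every element whose region contains x to be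
-- a pair of elements whose regions supply y and z. So the regions occurring
-- in models of the positive literals are generated by two rules: a region
-- obeying the union and difference literals is realizable if it lies in no
-- such x, or if a pair of realizable regions splits it. Only the variables of
-- φ matter, so these regions are found by saturating the finite list of all
-- regions, and φ is satisfiable iff each negative literal is refuted by
-- realizable regions. Soundness builds one set per derivation, labelling its
-- leaves by the regions on their path so that sets built for different
-- regions differ; completeness reads off, classically, the regions of the
-- elements of a model and shows by ∈-induction that they are all realizable.
module Submission where

open import Level using (Level; Lift; lift; lower) renaming (suc to lsuc)
open import Axiom.ExcludedMiddle using (ExcludedMiddle)
open import Axiom.DoubleNegationElimination using (DoubleNegationElimination; em⇒dne)
open import Data.Bool using (Bool; true; false; T; T?)
open import Data.Bool.Properties using (T-≡)
open import Data.Empty using (⊥; ⊥-elim)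
open import Data.Unit using (⊤; tt)
open import Data.Nat using (ℕ; zero; suc; _<_; _≤_; s≤s; s≤s⁻¹)
open import Data.Nat.Properties using (≤-trans; ≤-refl; suc-injective)
open import Data.Product using (Σ-syntax; _×_; _,_; proj₁; proj₂)
open import Data.Product.Function.NonDependent.Propositional using (_×-⇔_)
open import Data.Sum using (_⊎_; inj₁; inj₂; [_,_]′)
open import Data.Sum.Function.Propositional using (_⊎-⇔_)
open import Data.List using (List; []; _∷_; _++_; map; length; applyUpTo; filter; concatMap)
open import Data.List.Properties using (filter-notAll; ∷-injective; length-applyUpTo)
open import Data.List.Extrema.Nat using (max; xs≤max)
open import Data.List.Relation.Unary.All using (All; []; _∷_; all?)
import Data.List.Relation.Unary.All as All
open import Data.List.Relation.Unary.All.Properties using (++⁺; ¬All⇒Any¬)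
open import Data.List.Relation.Unary.Any using (Any; here; any?)
import Data.List.Relation.Unary.Any as Any
open import Data.List.Membership.Propositional using (_∈_; find; lose)
open import Data.List.Membership.Propositional.Properties
  using (∈-map⁺; ∈-map⁻; ∈-++⁺ˡ; ∈-++⁺ʳ; ∈-++⁻; ∈-filter⁺; ∈-filter⁻; ∈-concatMap⁺)
open import Function using (_∘_)
open import Function.Bundles using (_⇔_; mk⇔; Equivalence)
open import Function.Construct.Composition using (_⇔-∘_)
open import Function.Construct.Symmetry using (⇔-sym)
open import Function.Related.TypeIsomorphisms using (¬-cong-⇔)
open import Relation.Nullary using (¬_; Dec; yes; no; ¬?)
open import Relation.Nullary.Decidable
  using (⌊_⌋; map′; _×-dec_; _⊎-dec_; _→-dec_; toWitness; fromWitness; decidable-stable)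
open import Relation.Binary.PropositionalEquality
  using (_≡_; refl; sym; trans; cong; subst)
open import Defs

⇔-cong : {a a′ b b′ : Level} {A : Set a} {A′ : Set a′} {B : Set b} {B′ : Set b′} →
         A ⇔ A′ → B ⇔ B′ → (A ⇔ B) ⇔ (A′ ⇔ B′)
⇔-cong A⇔A′ B⇔B′ = mk⇔ (λ A⇔B → B⇔B′ ⇔-∘ (A⇔B ⇔-∘ ⇔-sym A⇔A′))
                        (λ A′⇔B′ → ⇔-sym B⇔B′ ⇔-∘ (A′⇔B′ ⇔-∘ A⇔A′))

_⇔?_ : {a b : Level} {A : Set a} {B : Set b} → Dec A → Dec B → Dec (A ⇔ B)
A? ⇔? B? = map′ (λ (f , g) → mk⇔ f g) (λ A⇔B → Equivalence.to A⇔B , Equivalence.from A⇔B)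
                ((A? →-dec B?) ×-dec (B? →-dec A?))

++-injective : {A : Set} (xs ys : List A) {us ws : List A} → length xs ≡ length ys →
               xs ++ us ≡ ys ++ ws → xs ≡ ys × us ≡ ws
++-injective []       []       _   eq = refl , eq
++-injective (x ∷ xs) (y ∷ ys) len eq with ∷-injective eq
... | refl , eq′ with ++-injective xs ys (suc-injective len) eq′
...   | refl , us≡ws = refl , us≡ws

private
  variable
    ℓ : Level
    a b c e e′ u v u′ v′ : V ℓ

≐-refl : (a : V ℓ) → a ≐ a
≐-refl (sup A f) = (λ i → i , ≐-refl (f i)) , (λ i → i , ≐-refl (f i))

≐-sym : a ≐ b → b ≐ a
≐-sym {a = sup A f} {b = sup B g} (p , q) =
  (λ j → proj₁ (q j) , ≐-sym (proj₂ (q j))) , (λ i → proj₁ (p i) , ≐-sym (proj₂ (p i)))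

≐-trans : a ≐ b → b ≐ c → a ≐ c
≐-trans {a = sup A f} {b = sup B g} {c = sup C h} (p , q) (p′ , q′) =
  (λ i → let (j , fi≐gj) = p i; (k , gj≐hk) = p′ j in k , ≐-trans fi≐gj gj≐hk) ,
  (λ k → let (j , gj≐hk) = q′ k; (i , fi≐gj) = q j in i , ≐-trans fi≐gj gj≐hk)

∈-resp-≐ˡ : e ≐ e′ → e ∈V a → e′ ∈V a
∈-resp-≐ˡ {a = sup A f} e≐e′ (i , e≐fi) = i , ≐-trans (≐-sym e≐e′) e≐fi

∈-resp-≐ʳ : a ≐ b → e ∈V a → e ∈V b
∈-resp-≐ʳ {a = sup A f} {b = sup B g} (p , _) (i , e≐fi) =
  proj₁ (p i) , ≐-trans e≐fi (proj₂ (p i))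

≐-ext : ((e : V ℓ) → e ∈V a → e ∈V b) → ((e : V ℓ) → e ∈V b → e ∈V a) → a ≐ b
≐-ext {a = sup A f} {b = sup B g} a⊆b b⊆a =
  (λ i → a⊆b (f i) (i , ≐-refl (f i))) ,
  (λ j → let (i , gj≐fi) = b⊆a (g j) (j , ≐-refl (g j)) in i , ≐-sym gj≐fi)

⊆⇒∈ : a ⊆V b → e ∈V a → e ∈V b
⊆⇒∈ {a = sup A f} a⊆b (i , e≐fi) = ∈-resp-≐ˡ (≐-sym e≐fi) (a⊆b i)

∈⇒⊆ : ((e : V ℓ) → e ∈V a → e ∈V b) → a ⊆V b
∈⇒⊆ {a = sup A f} a⊆b i = a⊆b (f i) (i , ≐-refl (f i))

∈-∪⁻ : e ∈V (a ∪V b) → e ∈V a ⊎ e ∈V b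
∈-∪⁻ {a = sup A f} {b = sup B g} (inj₁ i , r) = inj₁ (i , r)
∈-∪⁻ {a = sup A f} {b = sup B g} (inj₂ j , r) = inj₂ (j , r)

∈-∪⁺ : e ∈V a ⊎ e ∈V b → e ∈V (a ∪V b)
∈-∪⁺ {a = sup A f} {b = sup B g} (inj₁ (i , r)) = inj₁ i , r
∈-∪⁺ {a = sup A f} {b = sup B g} (inj₂ (j , r)) = inj₂ j , r

∈-∖⁻ : e ∈V (a ∖V b) → e ∈V a × ¬ e ∈V b
∈-∖⁻ {a = sup A f} ((i , fi∉b) , r) = (i , r) , fi∉b ∘ ∈-resp-≐ˡ r

∈-∖⁺ : e ∈V a × ¬ e ∈V b → e ∈V (a ∖V b)
∈-∖⁺ {a = sup A f} ((i , r) , e∉b) = (i , e∉b ∘ ∈-resp-≐ˡ (≐-sym r)) , r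

∈-pair⁻ : e ∈V pairV u v → e ≐ u ⊎ e ≐ v
∈-pair⁻ (lift true  , r) = inj₁ r
∈-pair⁻ (lift false , r) = inj₂ r

pairV-cong : u ≐ u′ → v ≐ v′ → pairV u v ≐ pairV u′ v′
pairV-cong u≐u′ v≐v′ =
  (λ { (lift true) → lift true , u≐u′ ; (lift false) → lift false , v≐v′ }) ,
  (λ { (lift true) → lift true , u≐u′ ; (lift false) → lift false , v≐v′ })

pairV-comm : (u v : V ℓ) → pairV u v ≐ pairV v u
pairV-comm u v =
  (λ { (lift true) → lift false , ≐-refl u ; (lift false) → lift true , ≐-refl v }) ,
  (λ { (lift true) → lift false , ≐-refl v ; (lift false) → lift true , ≐-refl u })

pairV-injective : pairV u v ≐ pairV u′ v′ → (u ≐ u′ × v ≐ v′) ⊎ (u ≐ v′ × v ≐ u′)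
pairV-injective (p , q) with p (lift true) | p (lift false)
... | lift true  , u≐u′ | lift false , v≐v′ = inj₁ (u≐u′ , v≐v′)
... | lift false , u≐v′ | lift true  , v≐u′ = inj₂ (u≐v′ , v≐u′)
... | lift true  , u≐u′ | lift true  , v≐u′ with q (lift false)
...   | lift true  , u≐v′ = inj₁ (u≐u′ , ≐-trans v≐u′ (≐-trans (≐-sym u≐u′) u≐v′))
...   | lift false , v≐v′ = inj₁ (u≐u′ , v≐v′)
pairV-injective (p , q) | lift false , u≐v′ | lift false , v≐v′ with q (lift true)
...   | lift true  , u≐u′ = inj₁ (u≐u′ , v≐v′)
...   | lift false , v≐u′ = inj₂ (u≐v′ , v≐u′)

pairV-pigeonhole : a ∈V pairV u v → b ∈V pairV u v → c ∈V pairV u v →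
                   a ≐ b ⊎ a ≐ c ⊎ b ≐ c
pairV-pigeonhole a∈ b∈ c∈ with ∈-pair⁻ a∈ | ∈-pair⁻ b∈ | ∈-pair⁻ c∈
... | inj₁ a≐u | inj₁ b≐u | _        = inj₁ (≐-trans a≐u (≐-sym b≐u))
... | inj₂ a≐v | inj₂ b≐v | _        = inj₁ (≐-trans a≐v (≐-sym b≐v))
... | inj₁ a≐u | inj₂ _   | inj₁ c≐u = inj₂ (inj₁ (≐-trans a≐u (≐-sym c≐u)))
... | inj₂ a≐v | inj₁ _   | inj₂ c≐v = inj₂ (inj₁ (≐-trans a≐v (≐-sym c≐v)))
... | inj₁ _   | inj₂ b≐v | inj₂ c≐v = inj₂ (inj₂ (≐-trans b≐v (≐-sym c≐v)))
... | inj₂ _   | inj₁ b≐u | inj₁ c≐u = inj₂ (inj₂ (≐-trans b≐u (≐-sym c≐u)))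

≐pairV-members : {A : Set ℓ} {f : A → V ℓ} → sup A f ≐ pairV u u′ →
                 Σ[ i ∈ A ] Σ[ i′ ∈ A ] sup A f ≐ pairV (f i) (f i′)
≐pairV-members r@(_ , q) with q (lift true) | q (lift false)
... | i , fi≐u | i′ , fi′≐u′ = i , i′ , ≐-trans r (pairV-cong (≐-sym fi≐u) (≐-sym fi′≐u′))

∈-⊗⁻ : e ∈V (a ⊗V b) → Σ[ u ∈ V ℓ ] Σ[ u′ ∈ V ℓ ] u ∈V a × u′ ∈V b × e ≐ pairV u u′
∈-⊗⁻ {a = sup A f} {b = sup B g} ((i , j) , r) =
  f i , g j , (i , ≐-refl (f i)) , (j , ≐-refl (g j)) , r

∈-⊗⁺ : u ∈V a → u′ ∈V b → e ≐ pairV u u′ → e ∈V (a ⊗V b)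
∈-⊗⁺ {a = sup A f} {b = sup B g} (i , u≐fi) (j , u′≐gj) r =
  (i , j) , ≐-trans r (pairV-cong u≐fi u′≐gj)

pairV-∈-⊗⁻ : pairV u u′ ∈V (a ⊗V b) → (u ∈V a × u′ ∈V b) ⊎ (u′ ∈V a × u ∈V b)
pairV-∈-⊗⁻ uu′∈ with w , w′ , w∈a , w′∈b , r ← ∈-⊗⁻ uu′∈ | pairV-injective r
... | inj₁ (u≐w , u′≐w′) = inj₁ (∈-resp-≐ˡ (≐-sym u≐w) w∈a , ∈-resp-≐ˡ (≐-sym u′≐w′) w′∈b)
... | inj₂ (u≐w′ , u′≐w) = inj₂ (∈-resp-≐ˡ (≐-sym u′≐w) w∈a , ∈-resp-≐ˡ (≐-sym u≐w′) w′∈b)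

∅V : V ℓ
∅V {ℓ} = sup (Lift ℓ ⊥) (λ ())

⟅_⟆ : V ℓ → V ℓ
⟅_⟆ {ℓ} a = sup (Lift ℓ ⊤) (λ _ → a)

∉∅V : ¬ e ∈V ∅V {ℓ}
∉∅V (() , _)

∈-⟅⟆ : (a : V ℓ) → a ∈V ⟅ a ⟆
∈-⟅⟆ a = lift tt , ≐-refl a

∈-⟅⟆⁻ : e ∈V ⟅ a ⟆ → e ≐ a
∈-⟅⟆⁻ (_ , r) = r

∈⇒≉∅V : e ∈V a → ¬ a ≐ ∅V
∈⇒≉∅V e∈a a≐∅ = ∉∅V (∈-resp-≐ʳ a≐∅ e∈a)

⟅⟆≉∅V : ¬ ⟅ a ⟆ ≐ ∅V
⟅⟆≉∅V {a = a} = ∈⇒≉∅V (∈-⟅⟆ a)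

⟅⟆-injective : ⟅ a ⟆ ≐ ⟅ b ⟆ → a ≐ b
⟅⟆-injective {a = a} r = ∈-⟅⟆⁻ (∈-resp-≐ʳ r (∈-⟅⟆ a))

⟅⟆≉pairV⟅⟆∅V : ¬ ⟅ a ⟆ ≐ pairV ⟅ b ⟆ ∅V
⟅⟆≉pairV⟅⟆∅V {b = b} r =
  ⟅⟆≉∅V (≐-trans (∈-⟅⟆⁻ (∈-resp-≐ʳ (≐-sym r) (lift true , ≐-refl ⟅ b ⟆)))
                 (≐-sym (∈-⟅⟆⁻ (∈-resp-≐ʳ (≐-sym r) (lift false , ≐-refl ∅V)))))

code : List Bool → V ℓ
code []           = ∅V
code (false ∷ bs) = ⟅ code bs ⟆
code (true  ∷ bs) = pairV ⟅ code bs ⟆ ∅V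

code-injective : (p q : List Bool) → code {ℓ} p ≐ code q → p ≡ q
code-injective []          []          _ = refl
code-injective []          (false ∷ q) r = ⊥-elim (⟅⟆≉∅V (≐-sym r))
code-injective []          (true ∷ q)  r = ⊥-elim (∈⇒≉∅V (lift false , ≐-refl ∅V) (≐-sym r))
code-injective (false ∷ p) []          r = ⊥-elim (⟅⟆≉∅V r)
code-injective (true ∷ p)  []          r = ⊥-elim (∈⇒≉∅V (lift false , ≐-refl ∅V) r)
code-injective (false ∷ p) (false ∷ q) r = cong (false ∷_) (code-injective p q (⟅⟆-injective r))
code-injective (false ∷ p) (true ∷ q)  r = ⊥-elim (⟅⟆≉pairV⟅⟆∅V r)
code-injective (true ∷ p)  (false ∷ q) r = ⊥-elim (⟅⟆≉pairV⟅⟆∅V (≐-sym r))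
code-injective (true ∷ p)  (true ∷ q)  r with pairV-injective r
... | inj₁ (cp≐cq , _) = cong (true ∷_) (code-injective p q (⟅⟆-injective cp≐cq))
... | inj₂ (cp≐∅ , _)  = ⊥-elim (⟅⟆≉∅V cp≐∅)

-- Three pairwise distinct members, so a leaf is never an unordered pair; the
-- third one carries the label.
leaf : List Bool → V ℓ
leaf p = pairV ∅V ⟅ ∅V ⟆ ∪V ⟅ ⟅ ⟅ code p ⟆ ⟆ ⟆

leaf≉pairV : (p : List Bool) → ¬ leaf {ℓ} p ≐ pairV u v
leaf≉pairV {u = u} {v = v} p r
  with pairV-pigeonhole (member (inj₁ (lift true , ≐-refl ∅V)))
                        (member (inj₁ (lift false , ≐-refl ⟅ ∅V ⟆)))
                        (member (inj₂ (∈-⟅⟆ ⟅ ⟅ code p ⟆ ⟆)))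
  where
    member : e ∈V pairV ∅V ⟅ ∅V ⟆ ⊎ e ∈V ⟅ ⟅ ⟅ code p ⟆ ⟆ ⟆ → e ∈V pairV u v
    member e∈ = ∈-resp-≐ʳ r (∈-∪⁺ e∈)
... | inj₁ ∅≐⟅∅⟆          = ⟅⟆≉∅V (≐-sym ∅≐⟅∅⟆)
... | inj₂ (inj₁ ∅≐label) = ⟅⟆≉∅V (≐-sym ∅≐label)
... | inj₂ (inj₂ r′)      = ⟅⟆≉∅V (≐-sym (⟅⟆-injective r′))

leaf∉⊗ : (p : List Bool) → ¬ leaf {ℓ} p ∈V (a ⊗V b)
leaf∉⊗ p leaf∈ with _ , _ , _ , _ , r ← ∈-⊗⁻ leaf∈ = leaf≉pairV p r

leaf-injective : (p q : List Bool) → leaf {ℓ} p ≐ leaf q → p ≡ q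
leaf-injective p q r with ∈-∪⁻ (∈-resp-≐ʳ r (∈-∪⁺ (inj₂ (∈-⟅⟆ ⟅ ⟅ code p ⟆ ⟆))))
... | inj₂ label≐label = code-injective p q (⟅⟆-injective (⟅⟆-injective (∈-⟅⟆⁻ label≐label)))
... | inj₁ label∈pair with ∈-pair⁻ label∈pair
...   | inj₁ label≐∅   = ⊥-elim (⟅⟆≉∅V label≐∅)
...   | inj₂ label≐⟅∅⟆ = ⊥-elim (⟅⟆≉∅V (⟅⟆-injective label≐⟅∅⟆))

-- Bit v of a region says whether it lies inside variable v; the variables
-- beyond the end of the list are outside.
Region : Set
Region = List Bool

_∋_ : Region → Var → Set
[]      ∋ _     = ⊥
(b ∷ _) ∋ zero  = T b
(_ ∷ R) ∋ suc v = R ∋ v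

_∋?_ : (R : Region) (v : Var) → Dec (R ∋ v)
[]      ∋? _     = no (λ ())
(b ∷ _) ∋? zero  = T? b
(_ ∷ R) ∋? suc v = R ∋? v

applyUpTo-∋ : (f : ℕ → Bool) {n v : ℕ} → v < n → applyUpTo f n ∋ v ⇔ T (f v)
applyUpTo-∋ f {v = zero}  (s≤s _)   = mk⇔ (λ t → t) (λ t → t)
applyUpTo-∋ f {v = suc v} (s≤s v<n) = applyUpTo-∋ (f ∘ suc) v<n

regions : ℕ → List Region
regions zero    = [] ∷ []
regions (suc n) = map (true ∷_) (regions n) ++ map (false ∷_) (regions n)

∈-regions : {n : ℕ} (R : Region) → length R ≡ n → R ∈ regions n
∈-regions         []          refl = here refl
∈-regions {suc n} (true ∷ R)  refl = ∈-++⁺ˡ (∈-map⁺ (true ∷_) (∈-regions R refl))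
∈-regions {suc n} (false ∷ R) refl =
  ∈-++⁺ʳ (map (true ∷_) (regions n)) (∈-map⁺ (false ∷_) (∈-regions R refl))

∈-regions⇒length : {n : ℕ} {R : Region} → R ∈ regions n → length R ≡ n
∈-regions⇒length {zero}  (here refl) = refl
∈-regions⇒length {suc n} R∈ with ∈-++⁻ (map (true ∷_) (regions n)) R∈
... | inj₁ R∈ᵗ with _ , R′∈ , refl ← ∈-map⁻ (true ∷_) R∈ᵗ  = cong suc (∈-regions⇒length R′∈)
... | inj₂ R∈ᶠ with _ , R′∈ , refl ← ∈-map⁻ (false ∷_) R∈ᶠ = cong suc (∈-regions⇒length R′∈)

-- Least fixed point, inside a finite universe U, of the rule "a is admitted
-- by S". Every productive round removes an element from the worklist rest,
-- so length U rounds reach a closed list.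
module Saturation {A : Set} {p : Level} (Admit : List A → A → Set p)
                  (admit? : (S : List A) (a : A) → Dec (Admit S a)) where

  Closed : List A → List A → Set p
  Closed U S = ∀ {a} → a ∈ U → Admit S a → a ∈ S

  saturate : ℕ → List A → List A → List A
  saturate zero    rest S = S
  saturate (suc k) rest S with filter (admit? S) rest
  ... | []          = S
  ... | new@(_ ∷ _) = saturate k (filter (¬? ∘ admit? S) rest) (new ++ S)

  saturate-closed : (U : List A) (k : ℕ) (rest S : List A) → length rest ≤ k →
                    (∀ {a} → a ∈ U → a ∈ S ⊎ a ∈ rest) → Closed U (saturate k rest S)
  saturate-closed U zero [] S _ cover a∈U _ with inj₁ a∈S ← cover a∈U = a∈S
  saturate-closed U (suc k) rest S len cover with filter (admit? S) rest in eq
  ... | [] = closed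
    where
      closed : Closed U S
      closed {a} a∈U admitted with cover a∈U
      ... | inj₁ a∈S    = a∈S
      ... | inj₂ a∈rest with () ← subst (a ∈_) eq (∈-filter⁺ (admit? S) a∈rest admitted)
  ... | new@(g ∷ _) = saturate-closed U k _ _ shorter cover′
    where
      shorter : length (filter (¬? ∘ admit? S) rest) ≤ k
      shorter
        with g∈rest , admitted ← ∈-filter⁻ (admit? S) {xs = rest} (subst (g ∈_) (sym eq) (here refl))
        = s≤s⁻¹ (≤-trans (filter-notAll (¬? ∘ admit? S) rest
                            (Any.map (λ { refl ¬admitted → ¬admitted admitted }) g∈rest)) len)
      cover′ : ∀ {a} → a ∈ U → a ∈ new ++ S ⊎ a ∈ filter (¬? ∘ admit? S) rest
      cover′ {a} a∈U with cover a∈U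
      ... | inj₁ a∈S = inj₁ (∈-++⁺ʳ new a∈S)
      ... | inj₂ a∈rest with admit? S a
      ...   | yes admitted = inj₁ (∈-++⁺ˡ (subst (a ∈_) eq (∈-filter⁺ (admit? S) a∈rest admitted)))
      ...   | no ¬admitted = inj₂ (∈-filter⁺ (¬? ∘ admit? S) a∈rest ¬admitted)

  saturate-preserves : {q : Level} (U : List A) (P : A → Set q) →
                       (∀ {S a} → All P S → a ∈ U → Admit S a → P a) →
                       (k : ℕ) (rest S : List A) → (∀ {a} → a ∈ rest → a ∈ U) →
                       All P S → All P (saturate k rest S)
  saturate-preserves U P step zero    rest S _ PS = PS
  saturate-preserves U P step (suc k) rest S rest⊆U PS with filter (admit? S) rest in eq
  ... | []          = PS
  ... | new@(_ ∷ _) = saturate-preserves U P step k _ _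
                        (rest⊆U ∘ proj₁ ∘ ∈-filter⁻ (¬? ∘ admit? S)) (++⁺ Pnew PS)
    where
      Pnew : All P new
      Pnew = All.tabulate λ a∈new →
        let (a∈rest , admitted) = ∈-filter⁻ (admit? S) {xs = rest} (subst (_ ∈_) (sym eq) a∈new)
        in step PS (rest⊆U a∈rest) admitted

  saturation : List A → List A
  saturation U = saturate (length U) U []

  saturation-closed : (U : List A) → Closed U (saturation U)
  saturation-closed U = saturate-closed U (length U) U [] ≤-refl inj₂

  saturation-preserves : {q : Level} (U : List A) (P : A → Set q) →
                         (∀ {S a} → All P S → a ∈ U → Admit S a → P a) → All P (saturation U)
  saturation-preserves U P step = saturate-preserves U P step (length U) U [] (λ a∈U → a∈U) []

atomVars : Atom → List Var
atomVars (union x y z)   = x ∷ y ∷ z ∷ []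
atomVars (diff x y z)    = x ∷ y ∷ z ∷ []
atomVars (subProd x y z) = x ∷ y ∷ z ∷ []

data Boolean : Atom → Set where
  union : {x y z : Var} → Boolean (union x y z)
  diff  : {x y z : Var} → Boolean (diff x y z)

-- Truth of a Boolean atom inside a single region; a product atom is not
-- decided by one region (it is trivially true here and handled by InProduct).
_⊩_ : Region → Atom → Set
R ⊩ union x y z   = R ∋ x ⇔ (R ∋ y ⊎ R ∋ z)
R ⊩ diff x y z    = R ∋ x ⇔ (R ∋ y × ¬ R ∋ z)
R ⊩ subProd _ _ _ = ⊤

_⊩?_ : (R : Region) (a : Atom) → Dec (R ⊩ a)
R ⊩? union x y z   = (R ∋? x) ⇔? ((R ∋? y) ⊎-dec (R ∋? z))
R ⊩? diff x y z    = (R ∋? x) ⇔? ((R ∋? y) ×-dec ¬? (R ∋? z))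
R ⊩? subProd _ _ _ = yes tt

InProduct : Region → Region → Var → Var → Set
InProduct R₁ R₂ y z = (R₁ ∋ y × R₂ ∋ z) ⊎ (R₂ ∋ y × R₁ ∋ z)

InProduct? : (R₁ R₂ : Region) (y z : Var) → Dec (InProduct R₁ R₂ y z)
InProduct? R₁ R₂ y z = ((R₁ ∋? y) ×-dec (R₂ ∋? z)) ⊎-dec ((R₂ ∋? y) ×-dec (R₁ ∋? z))

module Venn {ℓ : Level} (M : Assignment ℓ) (N : ℕ) where

  record _∼_ (e : V ℓ) (R : Region) : Set ℓ where
    constructor venn
    field ∈⇔∋ : {v : Var} → v < N → e ∈V M v ⇔ R ∋ v
  open _∼_ public

  ∈⇒∋ : {R : Region} {v : Var} → e ∼ R → v < N → e ∈V M v → R ∋ v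
  ∈⇒∋ e∼R v<N = Equivalence.to (∈⇔∋ e∼R v<N)

  ∋⇒∈ : {R : Region} {v : Var} → e ∼ R → v < N → R ∋ v → e ∈V M v
  ∋⇒∈ e∼R v<N = Equivalence.from (∈⇔∋ e∼R v<N)

  ∼-resp-≐ : {R : Region} → e ≐ e′ → e ∼ R → e′ ∼ R
  ∼-resp-≐ e≐e′ e∼R = venn λ v<N →
    ∈⇔∋ e∼R v<N ⇔-∘ mk⇔ (∈-resp-≐ˡ (≐-sym e≐e′)) (∈-resp-≐ˡ e≐e′)

  Pointwise : Atom → V ℓ → Set ℓ
  Pointwise (union x y z)   e = e ∈V M x ⇔ (e ∈V M y ⊎ e ∈V M z)
  Pointwise (diff x y z)    e = e ∈V M x ⇔ (e ∈V M y × ¬ e ∈V M z)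
  Pointwise (subProd _ _ _) _ = Lift ℓ ⊤

  ⟦⟧⇒pointwise : (a : Atom) → ⟦ M ⟧ᵃ a → (e : V ℓ) → Pointwise a e
  ⟦⟧⇒pointwise (union x y z)   r _ = mk⇔ (∈-∪⁻ ∘ ∈-resp-≐ʳ r) (∈-resp-≐ʳ (≐-sym r) ∘ ∈-∪⁺)
  ⟦⟧⇒pointwise (diff x y z)    r _ = mk⇔ (∈-∖⁻ ∘ ∈-resp-≐ʳ r) (∈-resp-≐ʳ (≐-sym r) ∘ ∈-∖⁺)
  ⟦⟧⇒pointwise (subProd _ _ _) _ _ = lift tt

  pointwise⇒⟦⟧ : {a : Atom} → Boolean a → (∀ {e v} → e ∈V M v → Pointwise a e) → ⟦ M ⟧ᵃ a
  pointwise⇒⟦⟧ union pw = ≐-ext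
    (λ e e∈x → ∈-∪⁺ (Equivalence.to (pw e∈x) e∈x))
    (λ e e∈y∪z → let e∈y⊎z = ∈-∪⁻ e∈y∪z in Equivalence.from ([ pw , pw ]′ e∈y⊎z) e∈y⊎z)
  pointwise⇒⟦⟧ diff pw = ≐-ext
    (λ e e∈x → ∈-∖⁺ (Equivalence.to (pw e∈x) e∈x))
    (λ e e∈y∖z → let e∈y×∉z = ∈-∖⁻ e∈y∖z in Equivalence.from (pw (proj₁ e∈y×∉z)) e∈y×∉z)

  pointwise⇔⊩ : {R : Region} → e ∼ R → (a : Atom) → All (_< N) (atomVars a) →
                Pointwise a e ⇔ R ⊩ a
  pointwise⇔⊩ e∼R (union x y z) (x<N ∷ y<N ∷ z<N ∷ []) =
    ⇔-cong (∈⇔∋ e∼R x<N) (∈⇔∋ e∼R y<N ⊎-⇔ ∈⇔∋ e∼R z<N)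
  pointwise⇔⊩ e∼R (diff x y z) (x<N ∷ y<N ∷ z<N ∷ []) =
    ⇔-cong (∈⇔∋ e∼R x<N) (∈⇔∋ e∼R y<N ×-⇔ ¬-cong-⇔ (∈⇔∋ e∼R z<N))
  pointwise⇔⊩ e∼R (subProd _ _ _) _ = mk⇔ (λ _ → tt) (λ _ → lift tt)

  pairV-∈-⊗⇒InProduct : {R₁ R₂ : Region} {y z : Var} → u ∼ R₁ → u′ ∼ R₂ → y < N → z < N →
                        pairV u u′ ∈V (M y ⊗V M z) → InProduct R₁ R₂ y z
  pairV-∈-⊗⇒InProduct u∼R₁ u′∼R₂ y<N z<N uu′∈ with pairV-∈-⊗⁻ uu′∈
  ... | inj₁ (u∈y , u′∈z) = inj₁ (∈⇒∋ u∼R₁ y<N u∈y , ∈⇒∋ u′∼R₂ z<N u′∈z)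
  ... | inj₂ (u′∈y , u∈z) = inj₂ (∈⇒∋ u′∼R₂ y<N u′∈y , ∈⇒∋ u∼R₁ z<N u∈z)

  InProduct⇒pairV-∈-⊗ : {R₁ R₂ : Region} {y z : Var} → u ∼ R₁ → u′ ∼ R₂ → y < N → z < N →
                        InProduct R₁ R₂ y z → pairV u u′ ∈V (M y ⊗V M z)
  InProduct⇒pairV-∈-⊗ {u = u} {u′ = u′} u∼R₁ u′∼R₂ y<N z<N (inj₁ (y∈R₁ , z∈R₂)) =
    ∈-⊗⁺ (∋⇒∈ u∼R₁ y<N y∈R₁) (∋⇒∈ u′∼R₂ z<N z∈R₂) (≐-refl (pairV u u′))
  InProduct⇒pairV-∈-⊗ {u = u} {u′ = u′} u∼R₁ u′∼R₂ y<N z<N (inj₂ (y∈R₂ , z∈R₁)) =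
    ∈-⊗⁺ (∋⇒∈ u′∼R₂ y<N y∈R₂) (∋⇒∈ u∼R₁ z<N z∈R₁) (pairV-comm u u′)

literalAtom : Literal → Atom
literalAtom (pos a) = a
literalAtom (neg a) = a

AnyPair : List Region → (Region → Region → Set) → Set
AnyPair S P = Any (λ R₁ → Any (λ R₂ → P R₁ R₂) S) S

anyPair? : (S : List Region) {P : Region → Region → Set} →
           ((R₁ R₂ : Region) → Dec (P R₁ R₂)) → Dec (AnyPair S P)
anyPair? S P? = any? (λ R₁ → any? (P? R₁) S) S

module Procedure (φ : Formula) where

  N : ℕ
  N = suc (max 0 (concatMap (atomVars ∘ literalAtom) φ))

  vars<N : {l : Literal} → l ∈ φ → All (_< N) (atomVars (literalAtom l))
  vars<N l∈φ = All.tabulate λ v∈ → s≤s (All.lookup (xs≤max 0 _)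
    (∈-concatMap⁺ (atomVars ∘ literalAtom) (Any.map (λ { refl → v∈ }) l∈φ)))

  Local : Region → Literal → Set
  Local R (pos a) = R ⊩ a
  Local R (neg _) = ⊤

  Idle : Region → Literal → Set
  Idle R (pos (subProd x _ _)) = ¬ R ∋ x
  Idle _ _                     = ⊤

  SplitsAt : Region → Region → Region → Literal → Set
  SplitsAt R R₁ R₂ (pos (subProd x y z)) = R ∋ x → InProduct R₁ R₂ y z
  SplitsAt _ _ _ _                       = ⊤

  Allowed : Region → Set
  Allowed R = All (Local R) φ

  Inactive : Region → Set
  Inactive R = All (Idle R) φ

  Splits : Region → Region → Region → Set
  Splits R R₁ R₂ = All (SplitsAt R R₁ R₂) φ

  RealizableFrom : List Region → Region → Set
  RealizableFrom S R = Allowed R × (Inactive R ⊎ AnyPair S (Splits R))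

  Local? : (R : Region) (l : Literal) → Dec (Local R l)
  Local? R (pos a) = R ⊩? a
  Local? R (neg _) = yes tt

  Idle? : (R : Region) (l : Literal) → Dec (Idle R l)
  Idle? R (pos (subProd x _ _)) = ¬? (R ∋? x)
  Idle? _ (pos (union _ _ _))   = yes tt
  Idle? _ (pos (diff _ _ _))    = yes tt
  Idle? _ (neg _)               = yes tt

  SplitsAt? : (R R₁ R₂ : Region) (l : Literal) → Dec (SplitsAt R R₁ R₂ l)
  SplitsAt? R R₁ R₂ (pos (subProd x y z)) = (R ∋? x) →-dec InProduct? R₁ R₂ y z
  SplitsAt? _ _ _   (pos (union _ _ _))   = yes tt
  SplitsAt? _ _ _   (pos (diff _ _ _))    = yes tt
  SplitsAt? _ _ _   (neg _)               = yes tt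

  Inactive? : (R : Region) → Dec (Inactive R)
  Inactive? R = all? (Idle? R) φ

  Splits? : (R R₁ R₂ : Region) → Dec (Splits R R₁ R₂)
  Splits? R R₁ R₂ = all? (SplitsAt? R R₁ R₂) φ

  realizableFrom? : (S : List Region) (R : Region) → Dec (RealizableFrom S R)
  realizableFrom? S R = all? (Local? R) φ ×-dec (Inactive? R ⊎-dec anyPair? S (Splits? R))

  data Realizable : Region → Set where
    inactive : {R : Region} → length R ≡ N → Allowed R → Inactive R → Realizable R
    split    : {R R₁ R₂ : Region} → length R ≡ N → Allowed R →
               Realizable R₁ → Realizable R₂ → Splits R R₁ R₂ → Realizable R

  realizable-length : {R : Region} → Realizable R → length R ≡ N
  realizable-length (inactive len _ _)  = len
  realizable-length (split len _ _ _ _) = len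

  realizable-allowed : {R : Region} → Realizable R → Allowed R
  realizable-allowed (inactive _ allowed _)  = allowed
  realizable-allowed (split _ allowed _ _ _) = allowed

  realizable-same-length : {R R′ : Region} → Realizable R → Realizable R′ → length R ≡ length R′
  realizable-same-length d d′ = trans (realizable-length d) (sym (realizable-length d′))

  open Saturation RealizableFrom realizableFrom?

  realizable : List Region
  realizable = saturation (regions N)

  ∈-realizable⇒Realizable : {R : Region} → R ∈ realizable → Realizable R
  ∈-realizable⇒Realizable = All.lookup (saturation-preserves (regions N) Realizable step)
    where
      step : {S : List Region} {R : Region} →
             All Realizable S → R ∈ regions N → RealizableFrom S R → Realizable R
      step _ R∈ (allowed , inj₁ idle) = inactive (∈-regions⇒length R∈) allowed idle
      step RS R∈ (allowed , inj₂ pair)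
        with R₁ , R₁∈S , pair′ ← find pair
        with R₂ , R₂∈S , splits ← find pair′ =
        split (∈-regions⇒length R∈) allowed (All.lookup RS R₁∈S) (All.lookup RS R₂∈S) splits

  RealizableFrom⇒∈-realizable : {R : Region} → length R ≡ N → RealizableFrom realizable R →
                                R ∈ realizable
  RealizableFrom⇒∈-realizable len = saturation-closed (regions N) (∈-regions _ len)

  -- R is realized by an element that is not a pair from y ⊗ z
  EscapesProduct : Var → Var → Region → Set
  EscapesProduct y z R =
    Inactive R ⊎ AnyPair realizable (λ R₁ R₂ → Splits R R₁ R₂ × ¬ InProduct R₁ R₂ y z)

  Refuted : Literal → Set
  Refuted (pos _)               = ⊤
  Refuted (neg (subProd x y z)) = Any (λ R → R ∋ x × EscapesProduct y z R) realizable
  Refuted (neg a)               = Any (λ R → ¬ R ⊩ a) realizable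

  refuted? : (l : Literal) → Dec (Refuted l)
  refuted? (pos _)               = yes tt
  refuted? (neg (subProd x y z)) = any? (λ R → (R ∋? x) ×-dec escapesProduct? R) realizable
    where
      escapesProduct? : (R : Region) → Dec (EscapesProduct y z R)
      escapesProduct? R = Inactive? R ⊎-dec
        anyPair? realizable (λ R₁ R₂ → Splits? R R₁ R₂ ×-dec ¬? (InProduct? R₁ R₂ y z))
  refuted? (neg (union x y z))   = any? (λ R → ¬? (R ⊩? union x y z)) realizable
  refuted? (neg (diff x y z))    = any? (λ R → ¬? (R ⊩? diff x y z)) realizable

  decision : Dec (All Refuted φ)
  decision = all? refuted? φ

  module Model (ℓ : Level) where

    -- Every leaf records the regions on its path to the root, so the sets
    -- built for different regions are never equal (build-region).
    build : List Bool → {R : Region} → Realizable R → V ℓ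
    build p {R} (inactive _ _ _)    = leaf (R ++ p)
    build p {R} (split _ _ d₁ d₂ _) = pairV (build (R ++ p) d₁) (build (R ++ p) d₂)

    build-injective : {p p′ : List Bool} {R R′ : Region} (d : Realizable R) (d′ : Realizable R′) →
                      build p d ≐ build p′ d′ → R ++ p ≡ R′ ++ p′
    build-injective (inactive _ _ _)  (inactive _ _ _)  r = leaf-injective _ _ r
    build-injective (inactive _ _ _)  (split _ _ _ _ _) r = ⊥-elim (leaf≉pairV _ r)
    build-injective (split _ _ _ _ _) (inactive _ _ _)  r = ⊥-elim (leaf≉pairV _ (≐-sym r))
    build-injective (split {R₁ = R₁} _ _ d₁ _ _) (split {R₁ = R₁′} {R₂′} _ _ d₁′ d₂′ _) r
      with pairV-injective r
    ... | inj₁ (b₁≐b₁′ , _) = proj₂ (++-injective R₁ R₁′ (realizable-same-length d₁ d₁′)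
                                                   (build-injective d₁ d₁′ b₁≐b₁′))
    ... | inj₂ (b₁≐b₂′ , _) = proj₂ (++-injective R₁ R₂′ (realizable-same-length d₁ d₂′)
                                                   (build-injective d₁ d₂′ b₁≐b₂′))

    build-region : {p p′ : List Bool} {R R′ : Region} (d : Realizable R) (d′ : Realizable R′) →
                   build p d ≐ build p′ d′ → R ≡ R′
    build-region {R = R} {R′} d d′ r =
      proj₁ (++-injective R R′ (realizable-same-length d d′) (build-injective d d′ r))

    Label : Var → Set
    Label v = Σ[ p ∈ List Bool ] Σ[ R ∈ Region ] Realizable R × R ∋ v

    M : Assignment ℓ
    M v = sup (Lift ℓ (Label v)) λ { (lift (p , _ , d , _)) → build p d }

    open Venn M N

    build-∼ : (p : List Bool) {R : Region} (d : Realizable R) → build p d ∼ R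
    build-∼ p {R} d = venn λ _ → mk⇔ region (λ v∈R → lift (p , R , d , v∈R) , ≐-refl (build p d))
      where
        region : {v : Var} → build p d ∈V M v → R ∋ v
        region {v} (lift (_ , _ , d′ , v∈R′) , r) = subst (_∋ v) (sym (build-region d d′ r)) v∈R′

    member-realized : {v : Var} → e ∈V M v → Σ[ R ∈ Region ] Realizable R × e ∼ R
    member-realized (lift (p , R , d , _) , e≐) = R , d , ∼-resp-≐ (≐-sym e≐) (build-∼ p d)

    boolean-sound : {a : Atom} → Boolean a → pos a ∈ φ → ⟦ M ⟧ᵃ a
    boolean-sound {a} boolean a∈φ = pointwise⇒⟦⟧ boolean λ e∈ →
      let (_ , d , e∼R) = member-realized e∈
      in Equivalence.from (pointwise⇔⊩ e∼R a (vars<N a∈φ)) (All.lookup (realizable-allowed d) a∈φ)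

    product-sound : {x y z : Var} → pos (subProd x y z) ∈ φ → ⟦ M ⟧ᵃ (subProd x y z)
    product-sound l∈φ (lift (_ , _ , inactive _ _ idle , x∈R)) = ⊥-elim (All.lookup idle l∈φ x∈R)
    product-sound l∈φ (lift (_ , _ , split _ _ d₁ d₂ splits , x∈R))
      with _ ∷ y<N ∷ z<N ∷ [] ← vars<N l∈φ =
      InProduct⇒pairV-∈-⊗ (build-∼ _ d₁) (build-∼ _ d₂) y<N z<N (All.lookup splits l∈φ x∈R)

    boolean-refuted : {a : Atom} → neg a ∈ φ → Any (λ R → ¬ R ⊩ a) realizable → ¬ ⟦ M ⟧ᵃ a
    boolean-refuted {a} a∈φ refuted holds with R , R∈ , R⊮a ← find refuted =
      R⊮a (Equivalence.to (pointwise⇔⊩ (build-∼ [] d) a (vars<N a∈φ))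
                          (⟦⟧⇒pointwise a holds (build [] d)))
      where d = ∈-realizable⇒Realizable R∈

    product-refuted : {x y z : Var} → neg (subProd x y z) ∈ φ → Refuted (neg (subProd x y z)) →
                      ¬ ⟦ M ⟧ᵃ (subProd x y z)
    product-refuted l∈φ refuted x⊆y⊗z with find refuted
    ... | R , R∈ , x∈R , inj₁ idle =
      leaf∉⊗ (R ++ []) (x⊆y⊗z (lift ([] , R , d′ , x∈R)))
      where d  = ∈-realizable⇒Realizable R∈
            d′ = inactive (realizable-length d) (realizable-allowed d) idle
    ... | R , R∈ , x∈R , inj₂ pair
      with R₁ , R₁∈ , pair′ ← find pair
      with R₂ , R₂∈ , splits , ∉y⊗z ← find pair′
      with _ ∷ y<N ∷ z<N ∷ [] ← vars<N l∈φ =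
      ∉y⊗z (pairV-∈-⊗⇒InProduct (build-∼ (R ++ []) d₁) (build-∼ (R ++ []) d₂) y<N z<N
             (x⊆y⊗z (lift ([] , R , d′ , x∈R))))
      where d  = ∈-realizable⇒Realizable R∈
            d₁ = ∈-realizable⇒Realizable R₁∈
            d₂ = ∈-realizable⇒Realizable R₂∈
            d′ = split (realizable-length d) (realizable-allowed d) d₁ d₂ splits

    literal-sound : (l : Literal) → l ∈ φ → Refuted l → ⟦ M ⟧ˡ l
    literal-sound (pos (union _ _ _))   l∈φ _ = boolean-sound union l∈φ
    literal-sound (pos (diff _ _ _))    l∈φ _ = boolean-sound diff l∈φ
    literal-sound (pos (subProd _ _ _)) l∈φ _ = product-sound l∈φ
    literal-sound (neg (union _ _ _))   l∈φ   = boolean-refuted l∈φ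
    literal-sound (neg (diff _ _ _))    l∈φ   = boolean-refuted l∈φ
    literal-sound (neg (subProd _ _ _)) l∈φ   = product-refuted l∈φ

    sound : All Refuted φ → Satisfiable ℓ φ
    sound refuted = M , All.tabulate λ {l} l∈φ → literal-sound l l∈φ (All.lookup refuted l∈φ)

  module Completeness {ℓ : Level} (em : ExcludedMiddle (lsuc ℓ))
                      (M : Assignment ℓ) (M⊨φ : All ⟦ M ⟧ˡ φ) where
    open Venn M N

    dne : DoubleNegationElimination (lsuc ℓ)
    dne = em⇒dne em

    ¬∀⇒∃¬ : {P : V ℓ → Set ℓ} → ¬ ((e : V ℓ) → P e) → Σ[ e ∈ V ℓ ] ¬ P e
    ¬∀⇒∃¬ ¬∀ = dne λ ∄ → ¬∀ λ e → lower (dne λ ¬Pe → ∄ (e , ¬Pe ∘ lift))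

    ¬⊆⇒∃ : ¬ a ⊆V b → Σ[ e ∈ V ℓ ] e ∈V a × ¬ e ∈V b
    ¬⊆⇒∃ ¬⊆ = dne λ ∄ → ¬⊆ (∈⇒⊆ λ e e∈a → lower (dne λ e∉b → ∄ (e , e∈a , e∉b ∘ lift)))

    member? : (e : V ℓ) (v : Var) → Dec (Lift (lsuc ℓ) (e ∈V M v))
    member? e v = em

    regionOf : V ℓ → Region
    regionOf e = applyUpTo (⌊_⌋ ∘ member? e) N

    regionOf-∼ : (e : V ℓ) → e ∼ regionOf e
    regionOf-∼ e = venn λ {v} v<N → mk⇔
      (λ e∈ → Equivalence.from (applyUpTo-∋ (⌊_⌋ ∘ member? e) v<N)
                               (fromWitness {a? = member? e v} (lift e∈)))
      (λ v∈ → lower (toWitness {a? = member? e v}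
                               (Equivalence.to (applyUpTo-∋ (⌊_⌋ ∘ member? e) v<N) v∈)))

    regionOf-length : (e : V ℓ) → length (regionOf e) ≡ N
    regionOf-length e = length-applyUpTo (⌊_⌋ ∘ member? e) N

    regionOf-allowed : (e : V ℓ) → Allowed (regionOf e)
    regionOf-allowed e = All.tabulate λ {l} → local l
      where
        local : (l : Literal) → l ∈ φ → Local (regionOf e) l
        local (pos a) l∈φ = Equivalence.to (pointwise⇔⊩ (regionOf-∼ e) a (vars<N l∈φ))
                                           (⟦⟧⇒pointwise a (All.lookup M⊨φ l∈φ) e)
        local (neg _) _   = tt

    regionOf-splits : e ≐ pairV u u′ → Splits (regionOf e) (regionOf u) (regionOf u′)
    regionOf-splits {e = e} {u = u} {u′ = u′} r = All.tabulate λ {l} → splitsAt l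
      where
        splitsAt : (l : Literal) → l ∈ φ → SplitsAt (regionOf e) (regionOf u) (regionOf u′) l
        splitsAt (pos (subProd x y z)) l∈φ x∈R with x<N ∷ y<N ∷ z<N ∷ [] ← vars<N l∈φ =
          pairV-∈-⊗⇒InProduct (regionOf-∼ u) (regionOf-∼ u′) y<N z<N
            (∈-resp-≐ˡ r (⊆⇒∈ (All.lookup M⊨φ l∈φ) (∋⇒∈ (regionOf-∼ e) x<N x∈R)))
        splitsAt (pos (union _ _ _)) _ = tt
        splitsAt (pos (diff _ _ _))  _ = tt
        splitsAt (neg _)             _ = tt

    active⇒pairV : ¬ Inactive (regionOf e) → Σ[ u ∈ V ℓ ] Σ[ u′ ∈ V ℓ ] e ≐ pairV u u′
    active⇒pairV {e = e} active with find (¬All⇒Any¬ (Idle? (regionOf e)) φ active)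
    ... | pos (subProd x y z) , l∈φ , ¬¬x∈R
      with x<N ∷ _ ← vars<N l∈φ
      with u , u′ , _ , _ , r ← ∈-⊗⁻ (⊆⇒∈ (All.lookup M⊨φ l∈φ) (∋⇒∈ (regionOf-∼ e) x<N
                                       (decidable-stable (regionOf e ∋? x) ¬¬x∈R)))
      = u , u′ , r
    ... | pos (union _ _ _) , _ , ¬tt = ⊥-elim (¬tt tt)
    ... | pos (diff _ _ _)  , _ , ¬tt = ⊥-elim (¬tt tt)
    ... | neg _             , _ , ¬tt = ⊥-elim (¬tt tt)

    regionOf-∈-realizable : (e : V ℓ) → regionOf e ∈ realizable
    regionOf-∈-realizable e@(sup A f) with Inactive? (regionOf e)
    ... | yes idle =
      RealizableFrom⇒∈-realizable (regionOf-length e) (regionOf-allowed e , inj₁ idle)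
    ... | no active
      with _ , _ , r ← active⇒pairV active
      with i , i′ , r′ ← ≐pairV-members r =
      RealizableFrom⇒∈-realizable (regionOf-length e)
        (regionOf-allowed e , inj₂ (lose (regionOf-∈-realizable (f i))
                                      (lose (regionOf-∈-realizable (f i′)) (regionOf-splits r′))))

    boolean-complete : {a : Atom} → Boolean a → neg a ∈ φ → ¬ ⟦ M ⟧ᵃ a →
                       Any (λ R → ¬ R ⊩ a) realizable
    boolean-complete {a} boolean l∈φ ¬holds
      with e , ¬pointwise ← ¬∀⇒∃¬ (λ pointwise → ¬holds (pointwise⇒⟦⟧ boolean (λ _ → pointwise _)))
      = lose (regionOf-∈-realizable e)
             (¬pointwise ∘ Equivalence.from (pointwise⇔⊩ (regionOf-∼ e) a (vars<N l∈φ)))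

    product-complete : {x y z : Var} → neg (subProd x y z) ∈ φ → ¬ ⟦ M ⟧ᵃ (subProd x y z) →
                       Refuted (neg (subProd x y z))
    product-complete {x} {y} {z} l∈φ ¬holds
      with x<N ∷ y<N ∷ z<N ∷ [] ← vars<N l∈φ
      with e , e∈x , e∉y⊗z ← ¬⊆⇒∃ ¬holds =
      lose (regionOf-∈-realizable e) (∈⇒∋ (regionOf-∼ e) x<N e∈x , escapes)
      where
        escapes : EscapesProduct y z (regionOf e)
        escapes with Inactive? (regionOf e)
        ... | yes idle  = inj₁ idle
        ... | no active with u , u′ , r ← active⇒pairV active =
          inj₂ (lose (regionOf-∈-realizable u) (lose (regionOf-∈-realizable u′)
            (regionOf-splits r , e∉y⊗z ∘ ∈-resp-≐ˡ (≐-sym r)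
                                       ∘ InProduct⇒pairV-∈-⊗ (regionOf-∼ u) (regionOf-∼ u′) y<N z<N)))

    literal-complete : (l : Literal) → l ∈ φ → ⟦ M ⟧ˡ l → Refuted l
    literal-complete (pos _)               _   _ = tt
    literal-complete (neg (union _ _ _))   l∈φ   = boolean-complete union l∈φ
    literal-complete (neg (diff _ _ _))    l∈φ   = boolean-complete diff l∈φ
    literal-complete (neg (subProd _ _ _)) l∈φ   = product-complete l∈φ

    complete : All Refuted φ
    complete = All.tabulate λ {l} l∈φ → literal-complete l l∈φ (All.lookup M⊨φ l∈φ)

theorem4 : SatDecider
theorem4 = record
  { decide  = λ φ → ⌊ Procedure.decision φ ⌋
  ; correct = λ ℓ em φ → let open Procedure φ in mk⇔
      (λ accepted → Model.sound ℓ (toWitness (Equivalence.from T-≡ accepted)))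
      (λ (M , M⊨φ) → Equivalence.to T-≡ (fromWitness (Completeness.complete em M M⊨φ)))
  }
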